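{- Let $q\ge 0$. The map sending a root-leaf path of the dual structure $T_q$ to the set of edges of $\triangle_q$ corresponding to the edges of that path is a one-to-one correspondence between root-leaf paths in $T_q$ and minimum $\sigma$-$\tau$ edge cuts in $\triangle_q$. Moreover, there are exactly $p=2^q$ pairwise different minimum $\sigma$-$\tau$ edge cuts in $\triangle_q$.
   Context: The $q$-triangle fractal $\triangle_q$ is built as follows: start with two vertices $\sigma,\tau$ joined by one edge, which is marked. Then repeat $q$ times: for every currently marked edge $e=\{a,b\}$ add a new vertex $w$ and the two new edges $\{a,w\},\{w,b\}$ (forming a triangle with $e$, called a triangle of depth $i$ in the $i$-th repetition), mark these new edges, and unmark all previously marked edges. The dual structure $T_q$ is the tree obtained from the planar dual of the natural plane embedding of $\triangle_q$ by splitting the vertex of the outer face into separate degree-one vertices; concretely: $T_q$ has one vertex per triangle, plus a root $r$ and one leaf per edge added in the last repetition (for $q\ge1$; for $q=0$, $T_0$ is a single edge between the root and one leaf). The root is joined to the depth-1 triangle by a tree edge corresponding to the edge $\{\sigma,\tau\}$; for each triangle of depth $i$ and each of its two newly added edges $e$, there is a tree edge corresponding to $e$ joining this triangle to the depth-$(i+1)$ triangle built on $e$ if $i<q$, or to a new leaf if $i=q$. This gives a bijection between edges of $T_q$ and edges of $\triangle_q$, and $T_q$ is a complete binary tree below the depth-1 triangle with $2^q$ leaves. A minimum $\sigma$-$\tau$ edge cut is an edge set of minimum cardinality whose removal disconnects $\sigma$ from $\tau$. -}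

module Defs where

open import Data.Bool using (Bool; true; false)
open import Data.Bool.Properties using () renaming (_≟_ to _≟B_)
open import Data.Nat using (ℕ; zero; suc; _≤_; _^_)
open import Data.Fin using (Fin; toℕ)
open import Data.Fin.Properties using () renaming (_≟_ to _≟F_)
open import Data.Vec using (Vec; []; _∷_)
import Data.Vec.Properties as VecP
import Data.Product.Properties as ProdP
open import Data.List using (List; []; _∷_; length; map; concatMap; filterᵇ; allFin)
open import Data.List.Relation.Unary.All using (All)
open import Data.List.Relation.Unary.Any using (Any)
open import Data.List.Relation.Unary.Unique.Propositional using (Unique)
open import Data.Product using (Σ; Σ-syntax; _×_; _,_)
open import Data.Sum using (_⊎_)
open import Relation.Nullary using (¬_; does)
open import Relation.Binary.PropositionalEquality using (_≡_)
open import Relation.Binary.Definitions using (DecidableEquality)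

module Walks {V E : Set} (ends : E → V × V) where

  Joins : E → V → V → Set
  Joins e u x = (ends e ≡ (u , x)) ⊎ (ends e ≡ (x , u))

  data Walk : V → V → List E → List V → Set where
    [] : ∀ {v} → Walk v v [] (v ∷ [])
    step : ∀ {u x v es vs} (e : E) → Joins e u x → Walk x v es vs →
           Walk u v (e ∷ es) (u ∷ vs)

  Path : V → V → List E → Set
  Path u v es = Σ[ vs ∈ List V ] (Walk u v es vs × Unique vs)

allWords : (j : ℕ) → List (Vec Bool j)
allWords zero = [] ∷ []
allWords (suc j) = map (false ∷_) (allWords j) Data.List.++ map (true ∷_) (allWords j)
  where import Data.List

-- The edges marked after repetition j (j = 0 : only {σ,τ}) are indexed by
-- words m ∈ Vec Bool j: the edge {σ,τ} is [], and the two edges added in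
-- repetition j+1 on the triangle built over the marked edge m are
-- (false ∷ m) = {a , w m} and (true ∷ m) = {w m , b}, where {a , b} = m.
-- Hence the edges of △_q are exactly the pairs (j , m) with j ≤ q.

data Vtx : Set where
  σ τ : Vtx
  -- the vertex added in repetition j+1 on the marked edge m (present in △_q iff j < q)
  w : (j : ℕ) → Vec Bool j → Vtx

endsΔ : ∀ {j} → Vec Bool j → Vtx × Vtx
endsΔ [] = σ , τ
endsΔ {suc j} (false ∷ m) with endsΔ m
... | a , b = a , w j m
endsΔ {suc j} (true ∷ m) with endsΔ m
... | a , b = w j m , b

-- edges of △_q (equivalently, of T_q)
Edge : ℕ → Set
Edge q = Σ[ j ∈ Fin (suc q) ] Vec Bool (toℕ j)

_≟E_ : ∀ {q} → DecidableEquality (Edge q)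
_≟E_ = ProdP.≡-dec _≟F_ (VecP.≡-dec _≟B_)

allEdges : (q : ℕ) → List (Edge q)
allEdges q = concatMap (λ j → map (j ,_) (allWords (toℕ j))) (allFin (suc q))

endsTri : (q : ℕ) → Edge q → Vtx × Vtx
endsTri q (j , m) = endsΔ m

EdgeSet : ℕ → Set
EdgeSet q = Edge q → Bool

card : ∀ {q} → EdgeSet q → ℕ
card {q} C = length (filterᵇ C (allEdges q))

_≗E_ : ∀ {q} → EdgeSet q → EdgeSet q → Set
C ≗E D = ∀ e → C e ≡ D e

module WΔ (q : ℕ) = Walks (endsTri q)

IsCut : (q : ℕ) → EdgeSet q → Set
IsCut q C = ∀ es vs → WΔ.Walk q σ τ es vs → Any (λ e → C e ≡ true) es

IsMinCut : (q : ℕ) → EdgeSet q → Set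
IsMinCut q C = IsCut q C × (∀ D → IsCut q D → card C ≤ card D)

-- The dual tree T_q.  Vertices: the root r, and node j m for the marked
-- edge m of stage j: for j < q this is the triangle (of depth j+1) built
-- on m, for j = q it is the leaf attached to m.

data TVtx : Set where
  root : TVtx
  node : (j : ℕ) → Vec Bool j → TVtx

-- the tree edge corresponding to the edge m of △_q joins the triangle in
-- which m was created (root for m = {σ,τ}) with node j m.
endsT : ∀ {j} → Vec Bool j → TVtx × TVtx
endsT [] = root , node 0 []
endsT {suc j} (b ∷ m) = node j m , node (suc j) (b ∷ m)

endsTree : (q : ℕ) → Edge q → TVtx × TVtx
endsTree q (j , m) = endsT m

module WT (q : ℕ) = Walks (endsTree q)

RootLeafPath : (q : ℕ) → List (Edge q) → Set
RootLeafPath q es = Σ[ m ∈ Vec Bool q ] WT.Path q root (node q m) es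

pathEdges : ∀ {q} → List (Edge q) → EdgeSet q
pathEdges [] e = false
pathEdges (e' ∷ es) e with does (e ≟E e')
... | true = true
... | false = pathEdges es e

module Submission where

-- An edge of △_q is addressed by a binary word: {σ,τ} is the empty word and
-- the two edges built on the edge m are false ∷ m and true ∷ m.  A leaf of
-- T_q is a word t of length q, and the root-leaf path to t uses exactly the
-- edges whose words are suffixes of t; call this edge set the path cut of t.
--  1. The edges of any level L (words of length L) form a σ-τ walk, so every
--     cut has an edge on each of the q + 1 levels: card C ≥ q + 1.
--  2. A 2-colouring of the vertices shows that a path cut is a cut; it has
--     one edge per level, hence it is a minimum cut.
--  3. A minimum cut C therefore has exactly one edge per level, and C
--     contains the parent of each of its edges (else a level walk, rerouted
--     around C's edge, avoids C).  So C is the path cut of its level-q word.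
--  4. In T_q each leaf has a unique root-leaf path, whose edge set is the
--     path cut of the leaf (it is the spine of suffixes of the leaf word).

open import Defs
open import Data.Bool using (Bool; true; false; T)
open import Data.Bool.Properties using (⇔→≡; ¬-not) renaming (_≟_ to _≟B_)
open import Data.Empty using (⊥; ⊥-elim)
open import Data.Fin using (Fin; toℕ; fromℕ<)
open import Data.Fin.Properties using (toℕ-fromℕ<; toℕ-injective; toℕ<n)
open import Data.List using (List; []; _∷_; _++_; length; map; concatMap; filterᵇ; allFin)
open import Data.Nat.ListAction using (sum)
open import Data.List.Properties using (length-++; length-map; length-tabulate; filter-++; filter-some)
open import Data.List.Membership.Propositional using (_∈_)
open import Data.List.Membership.Propositional.Properties
  using (∈-map⁺; ∈-map⁻; ∈-++⁺ˡ; ∈-++⁺ʳ; ∈-++⁻; ∈-allFin)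
open import Data.List.Relation.Unary.All using (All; []; _∷_)
import Data.List.Relation.Unary.All as All
import Data.List.Relation.Unary.All.Properties as AllP
open import Data.List.Relation.Unary.Any using (Any; here; there)
import Data.List.Relation.Unary.Any as Any
import Data.List.Relation.Unary.Any.Properties as AnyP
open import Data.List.Relation.Unary.AllPairs using (AllPairs; []; _∷_)
import Data.List.Relation.Unary.AllPairs as AllPairs
import Data.List.Relation.Unary.AllPairs.Properties as AllPairsP
open import Data.List.Relation.Unary.Unique.Propositional using (Unique)
import Data.List.Relation.Unary.Unique.Propositional.Properties as UniqueP
open import Data.Nat using (ℕ; zero; suc; _+_; _^_; _≤_; _<_; z≤n; s≤s; s≤s⁻¹)
open import Data.Nat.Properties
open import Data.Product using (Σ; Σ-syntax; _×_; _,_; proj₁; proj₂)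
import Data.Product.Properties as ProdP
open import Data.Sum using (_⊎_; inj₁; inj₂; [_,_]′)
open import Data.Unit using (tt)
open import Data.Vec using (Vec; []; _∷_; replicate)
import Data.Vec.Properties as VecP
open import Function using (_∘_; _⇔_; mk⇔; Equivalence)
import Function.Properties.Equivalence as ⇔
open import Relation.Binary.Definitions using (DecidableEquality)
open import Relation.Binary.PropositionalEquality
open import Relation.Nullary using (¬_; Dec; yes; no; does)
open import Relation.Nullary.Decidable using (dec-true; dec-false; T?)

head∉tail : ∀ {A : Set} {x : A} {xs} → Unique (x ∷ xs) → ¬ x ∈ xs
head∉tail (x∉xs ∷ _) = AllP.All¬⇒¬Any x∉xs

from-does : ∀ {P : Set} (d : Dec P) → does d ≡ true → P
from-does (yes p) _ = p

-- Binary words address the edges of △_q (and of T_q); the suffix order on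
-- words is the ancestor order of the corresponding tree edges.

Word : Set
Word = Σ ℕ (Vec Bool)

_≟W_ : DecidableEquality Word
_≟W_ = ProdP.≡-dec _≟_ (VecP.≡-dec _≟B_)

word-injective-at : ∀ {k} {m m′ : Vec Bool k} → _≡_ {A = Word} (k , m) (k , m′) → m ≡ m′
word-injective-at refl = refl

infix 4 _≼_
data _≼_ : ∀ {j k} → Vec Bool j → Vec Bool k → Set where
  here  : ∀ {j} {m : Vec Bool j} → m ≼ m
  there : ∀ {j k} {m : Vec Bool j} {t : Vec Bool k} {c} → m ≼ t → m ≼ (c ∷ t)

≼-∷⁻ : ∀ {j k c} {m : Vec Bool j} {t : Vec Bool k} → m ≼ (c ∷ t) →
       _≡_ {A = Word} (j , m) (suc k , c ∷ t) ⊎ m ≼ t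
≼-∷⁻ here = inj₁ refl
≼-∷⁻ (there p) = inj₂ p

_≼?_ : ∀ {j k} (m : Vec Bool j) (t : Vec Bool k) → Dec (m ≼ t)
[] ≼? [] = yes here
(_ ∷ _) ≼? [] = no (λ ())
m ≼? (c ∷ t) with (_ , m) ≟W (_ , c ∷ t) | m ≼? t
... | yes refl | _ = yes here
... | no _ | yes p = yes (there p)
... | no m≢ct | no m⋠t = no (λ p → [ m≢ct , m⋠t ]′ (≼-∷⁻ p))

≼-cast : ∀ {j j′ k} {m : Vec Bool j} {m′ : Vec Bool j′} {t : Vec Bool k} →
         _≡_ {A = Word} (j , m) (j′ , m′) → m′ ≼ t → m ≼ t
≼-cast refl p = p

≼-length : ∀ {j k} {m : Vec Bool j} {t : Vec Bool k} → m ≼ t → j ≤ k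
≼-length here = ≤-refl
≼-length (there p) = m≤n⇒m≤1+n (≼-length p)

≼-tail : ∀ {j k b} {m : Vec Bool j} {t : Vec Bool k} → (b ∷ m) ≼ t → m ≼ t
≼-tail here = there here
≼-tail (there p) = there (≼-tail p)

[]≼ : ∀ {k} (t : Vec Bool k) → [] ≼ t
[]≼ [] = here
[]≼ (_ ∷ t) = there ([]≼ t)

≼[] : ∀ {j} {m : Vec Bool j} → m ≼ [] → _≡_ {A = Word} (j , m) (0 , [])
≼[] here = refl

≼-unique : ∀ {j j′ k} {m : Vec Bool j} {m′ : Vec Bool j′} {t : Vec Bool k} →
           m ≼ t → m′ ≼ t → j ≡ j′ → _≡_ {A = Word} (j , m) (j′ , m′)
≼-unique here here _ = refl
≼-unique here (there p′) refl = ⊥-elim (1+n≰n (≼-length p′))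
≼-unique (there p) here refl = ⊥-elim (1+n≰n (≼-length p))
≼-unique (there p) (there p′) eq = ≼-unique p p′ eq

suffix : ∀ {n} k → k ≤ n → (t : Vec Bool n) → Σ (Vec Bool k) (_≼ t)
suffix zero _ t = [] , []≼ t
suffix (suc k) k<n (c ∷ t) with m≤n⇒m<n∨m≡n k<n
... | inj₁ (s≤s k<n′) = let (x , x≼t) = suffix (suc k) k<n′ t in x , there x≼t
... | inj₂ refl = c ∷ t , here

≼-child : ∀ {j k} {m : Vec Bool j} {t : Vec Bool k} → m ≼ t → j < k →
          (false ∷ m) ≼ t ⊎ (true ∷ m) ≼ t
≼-child {t = t} m≼t j<k with suffix _ j<k t
... | false ∷ x , x≼t with ≼-unique (≼-tail x≼t) m≼t refl
...   | refl = inj₁ x≼t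
≼-child {t = t} m≼t j<k | true ∷ x , x≼t with ≼-unique (≼-tail x≼t) m≼t refl
...   | refl = inj₂ x≼t

module _ {q : ℕ} where

  level : Edge q → ℕ
  level e = toℕ (proj₁ e)

  word : Edge q → Word
  word (j , m) = toℕ j , m

  word-injective : ∀ {e e′ : Edge q} → word e ≡ word e′ → e ≡ e′
  word-injective {j , _} {j′ , _} eq with toℕ-injective (cong proj₁ eq)
  ... | refl with eq
  ...   | refl = refl

  toℕ≤q : (j : Fin (suc q)) → toℕ j ≤ q
  toℕ≤q j = s≤s⁻¹ (toℕ<n j)

  level≤ : (e : Edge q) → level e ≤ q
  level≤ e = toℕ≤q (proj₁ e)

  edgeAt : ∀ k → .(k ≤ q) → Vec Bool k → Edge q
  edgeAt k k≤q m = fromℕ< (s≤s k≤q) , subst (Vec Bool) (sym (toℕ-fromℕ< (s≤s k≤q))) m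

  word-edgeAt : ∀ k .(k≤q : k ≤ q) (m : Vec Bool k) → word (edgeAt k k≤q m) ≡ (k , m)
  word-edgeAt k k≤q m = transported (toℕ-fromℕ< (s≤s k≤q))
    where
    transported : ∀ {a} (eq : a ≡ k) → _≡_ {A = Word} (a , subst (Vec Bool) (sym eq) m) (k , m)
    transported refl = refl

  edgeAt-word : (e : Edge q) → e ≡ edgeAt (level e) (level≤ e) (proj₂ e)
  edgeAt-word e = word-injective (sym (word-edgeAt _ (level≤ e) (proj₂ e)))

wordEnds : Word → Vtx × Vtx
wordEnds (_ , m) = endsΔ m

ends-edgeAt : ∀ {q} k .(k≤q : k ≤ q) (m : Vec Bool k) → endsTri q (edgeAt k k≤q m) ≡ endsΔ m
ends-edgeAt k k≤q m = cong wordEnds (word-edgeAt k k≤q m)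

ends-false : ∀ {j} (m : Vec Bool j) → endsΔ (false ∷ m) ≡ (proj₁ (endsΔ m) , w j m)
ends-false m with endsΔ m
... | _ , _ = refl

ends-true : ∀ {j} (m : Vec Bool j) → endsΔ (true ∷ m) ≡ (w j m , proj₂ (endsΔ m))
ends-true m with endsΔ m
... | _ , _ = refl

count : ∀ {A : Set} → (A → Bool) → List A → ℕ
count D xs = length (filterᵇ D xs)

module _ {A : Set} where

  count-++ : ∀ D (xs ys : List A) → count D (xs ++ ys) ≡ count D xs + count D ys
  count-++ D xs ys = trans (cong length (filter-++ (T? ∘ D) xs ys)) (length-++ (filterᵇ D xs))

  count-cong : ∀ {C D : A → Bool} → (∀ x → C x ≡ D x) → ∀ xs → count C xs ≡ count D xs
  count-cong C≗D [] = refl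
  count-cong {C} {D} C≗D (x ∷ xs) with C x | D x | C≗D x
  ... | true  | true  | _ = cong suc (count-cong C≗D xs)
  ... | false | false | _ = count-cong C≗D xs

  count-map : ∀ {B : Set} D (f : B → A) xs → count D (map f xs) ≡ count (D ∘ f) xs
  count-map D f [] = refl
  count-map D f (x ∷ xs) with D (f x)
  ... | true  = cong suc (count-map D f xs)
  ... | false = count-map D f xs

  count-positive : ∀ D {x} {xs : List A} → x ∈ xs → D x ≡ true → 1 ≤ count D xs
  count-positive D x∈xs Dx =
    filter-some (T? ∘ D) (Any.map (λ { refl → subst T (sym Dx) tt }) x∈xs)

  count-head : ∀ D {x} (xs : List A) → D x ≡ true → count D (x ∷ xs) ≡ suc (count D xs)
  count-head D {x} xs Dx with D x
  count-head D xs refl | .true = refl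

  count-tail : ∀ D x (xs : List A) → count D xs ≤ count D (x ∷ xs)
  count-tail D x xs with D x
  ... | true  = n≤1+n _
  ... | false = ≤-refl

  count-none : ∀ D {xs : List A} → (∀ {y} → y ∈ xs → D y ≢ true) → count D xs ≡ 0
  count-none D {[]} _ = refl
  count-none D {y ∷ ys} none with D y in Dy
  ... | true  = ⊥-elim (none (here refl) Dy)
  ... | false = count-none D (none ∘ there)

  count-≤1 : ∀ D → (∀ x y → D x ≡ true → D y ≡ true → x ≡ y) →
             ∀ {xs : List A} → Unique xs → count D xs ≤ 1
  count-≤1 D one {[]} [] = z≤n
  count-≤1 D one {x ∷ xs} u@(_ ∷ u′) with D x in Dx
  ... | true  = s≤s (≤-reflexive (count-none D others))
    where
    others : ∀ {y} → y ∈ xs → D y ≢ true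
    others y∈xs Dy = head∉tail u (subst (_∈ xs) (sym (one _ _ Dx Dy)) y∈xs)
  ... | false = count-≤1 D one u′

  count-≥2 : ∀ D {x y} (xs : List A) → D x ≡ true → y ∈ xs → D y ≡ true → 2 ≤ count D (x ∷ xs)
  count-≥2 D xs Dx y∈xs Dy = subst (2 ≤_) (sym (count-head D xs Dx)) (s≤s (count-positive D y∈xs Dy))

  count-≤1⇒unique : ∀ D {x y} {xs : List A} → count D xs ≤ 1 →
                    x ∈ xs → y ∈ xs → D x ≡ true → D y ≡ true → x ≡ y
  count-≤1⇒unique D c (here refl) (here refl) _ _ = refl
  count-≤1⇒unique D {xs = _ ∷ xs} c (here refl) (there y∈) Dx Dy =
    ⊥-elim (1+n≰n (≤-trans (count-≥2 D xs Dx y∈ Dy) c))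
  count-≤1⇒unique D {xs = _ ∷ xs} c (there x∈) (here refl) Dx Dy =
    ⊥-elim (1+n≰n (≤-trans (count-≥2 D xs Dy x∈ Dx) c))
  count-≤1⇒unique D {xs = z ∷ xs} c (there x∈) (there y∈) Dx Dy =
    count-≤1⇒unique D (≤-trans (count-tail D z xs) c) x∈ y∈ Dx Dy

  count-concatMap : ∀ {B : Set} D (g : B → List A) xs →
                    count D (concatMap g xs) ≡ sum (map (count D ∘ g) xs)
  count-concatMap D g [] = refl
  count-concatMap D g (x ∷ xs) =
    trans (count-++ D (g x) (concatMap g xs)) (cong (count D (g x) +_) (count-concatMap D g xs))

module _ {A : Set} (f : A → ℕ) where

  sum-≥-length : (∀ x → 1 ≤ f x) → ∀ xs → length xs ≤ sum (map f xs)
  sum-≥-length pos [] = z≤n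
  sum-≥-length pos (x ∷ xs) = +-mono-≤ (pos x) (sum-≥-length pos xs)

  sum-≤-length : (∀ x → f x ≤ 1) → ∀ xs → sum (map f xs) ≤ length xs
  sum-≤-length one [] = z≤n
  sum-≤-length one (x ∷ xs) = +-mono-≤ (one x) (sum-≤-length one xs)

  sum-tight : (∀ x → 1 ≤ f x) → ∀ {x} xs → sum (map f xs) ≤ length xs → x ∈ xs → f x ≤ 1
  sum-tight pos (y ∷ ys) tight (here refl) =
    +-cancelʳ-≤ (length ys) (f y) 1 (≤-trans (+-monoʳ-≤ (f y) (sum-≥-length pos ys)) tight)
  sum-tight pos (y ∷ ys) tight (there x∈ys) =
    sum-tight pos ys (+-cancelˡ-≤ 1 _ _ (≤-trans (+-monoˡ-≤ _ (pos y)) tight)) x∈ys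

allWords-complete : ∀ {j} (m : Vec Bool j) → m ∈ allWords j
allWords-complete [] = here refl
allWords-complete (false ∷ m) = ∈-++⁺ˡ (∈-map⁺ (false ∷_) (allWords-complete m))
allWords-complete {suc j} (true ∷ m) =
  ∈-++⁺ʳ (map (false ∷_) (allWords j)) (∈-map⁺ (true ∷_) (allWords-complete m))

allWords-unique : ∀ j → Unique (allWords j)
allWords-unique zero = [] ∷ []
allWords-unique (suc j) =
  UniqueP.++⁺ (UniqueP.map⁺ VecP.∷-injectiveʳ (allWords-unique j))
              (UniqueP.map⁺ VecP.∷-injectiveʳ (allWords-unique j)) disjoint
  where
  disjoint : ∀ {v} → ¬ (v ∈ map (false ∷_) (allWords j) × v ∈ map (true ∷_) (allWords j))
  disjoint (v∈₀ , v∈₁) with ∈-map⁻ (false ∷_) v∈₀ | ∈-map⁻ (true ∷_) v∈₁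
  ... | _ , _ , refl | _ , _ , ()

allWords-length : ∀ j → length (allWords j) ≡ 2 ^ j
allWords-length zero = refl
allWords-length (suc j) = begin
  length (map (false ∷_) ws ++ map (true ∷_) ws)  ≡⟨ length-++ (map (false ∷_) ws) ⟩
  length (map (false ∷_) ws) + length (map (true ∷_) ws)
    ≡⟨ cong₂ _+_ (length-map (false ∷_) ws) (length-map (true ∷_) ws) ⟩
  length ws + length ws                             ≡⟨ cong₂ _+_ (allWords-length j) (allWords-length j) ⟩
  2 ^ j + 2 ^ j                                     ≡⟨ cong (2 ^ j +_) (sym (+-identityʳ (2 ^ j))) ⟩
  2 ^ suc j                                         ∎
  where
  open ≡-Reasoning
  ws = allWords j

module WalkFacts {V E : Set} (ends : E → V × V) where
  open Walks ends

  start∈ : ∀ {u v es vs} → Walk u v es vs → u ∈ vs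
  start∈ [] = here refl
  start∈ (step _ _ _) = here refl

  _▹_ : ∀ {u v x es es′ vs vs′} → Walk u v es vs → Walk v x es′ vs′ →
        Σ[ vs″ ∈ List V ] Walk u x (es ++ es′) vs″
  [] ▹ w₂ = _ , w₂
  step e j w₁ ▹ w₂ = _ , step e j (proj₂ (w₁ ▹ w₂))

  snoc : ∀ {u v x es vs} {e : E} → Walk u v es vs → Joins e v x →
         Walk u x (es ++ e ∷ []) (vs ++ x ∷ [])
  snoc [] j = step _ j []
  snoc (step e′ j′ wk) j = step e′ j′ (snoc wk j)

  Bichromatic : (V → Bool) → E → Set
  Bichromatic f e = ¬ (f (proj₁ (ends e)) ≡ f (proj₂ (ends e)))

  joins-bichromatic : ∀ f {e u x} → Joins e u x → f u ≡ true → f x ≡ false → Bichromatic f e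
  joins-bichromatic f (inj₁ e≡ux) fu fx same rewrite e≡ux with () ← trans (sym fu) (trans same fx)
  joins-bichromatic f (inj₂ e≡xu) fu fx same rewrite e≡xu with () ← trans (sym fu) (trans (sym same) fx)

  crosses : ∀ f {u v es vs} → Walk u v es vs → f u ≡ true → f v ≡ false → Any (Bichromatic f) es
  crosses f [] fu fv with () ← trans (sym fu) fv
  crosses f (step {x = x} e j wk) fu fv with f x in fx
  ... | true  = there (crosses f wk fx fv)
  ... | false = here (joins-bichromatic f j fu fx)

module Detours (q : ℕ) where
  open WΔ q
  open WalkFacts (endsTri q)

  Detour : (Edge q → Set) → ∀ {k} → Vec Bool k → Set
  Detour P m = Σ[ es ∈ List (Edge q) ] Σ[ vs ∈ List Vtx ]
               (Walk (proj₁ (endsΔ m)) (proj₂ (endsΔ m)) es vs × All P es)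

  detour-edge : ∀ {P k} .(k≤q : k ≤ q) (m : Vec Bool k) → P (edgeAt k k≤q m) → Detour P m
  detour-edge k≤q m Pm = _ , _ , step (edgeAt _ k≤q m) (inj₁ (ends-edgeAt _ k≤q m)) [] , Pm ∷ []

  detour-split : ∀ {P k} {m : Vec Bool k} → Detour P (false ∷ m) → Detour P (true ∷ m) → Detour P m
  detour-split {m = m} (es₁ , vs₁ , w₁ , P₁) (es₂ , vs₂ , w₂ , P₂) =
    es₁ ++ es₂ , proj₁ joined , proj₂ joined , AllP.++⁺ P₁ P₂
    where
    joined : Σ[ vs ∈ List Vtx ] Walk (proj₁ (endsΔ m)) (proj₂ (endsΔ m)) (es₁ ++ es₂) vs
    joined = subst (λ p → Walk (proj₁ p) (proj₂ p) es₁ vs₁) (ends-false m) w₁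
           ▹ subst (λ p → Walk (proj₁ p) (proj₂ p) es₂ vs₂) (ends-true m) w₂

  detour-from-level : ∀ {P} L → (∀ {k} (m : Vec Bool k) → k ≡ L → Detour P m) → Detour P {0} []
  detour-from-level {P} L base = below L [] refl
    where
    below : ∀ d {k} (m : Vec Bool k) → k + d ≡ L → Detour P m
    below zero m eq = base m (trans (sym (+-identityʳ _)) eq)
    below (suc d) {k} m eq = detour-split (below d (false ∷ m) eq′) (below d (true ∷ m) eq′)
      where
      eq′ : suc k + d ≡ L
      eq′ = trans (sym (+-suc k d)) eq

  cut-meets : ∀ {P C} → IsCut q C → Detour P {0} [] → Σ[ e ∈ Edge q ] (C e ≡ true × P e)
  cut-meets cut (es , vs , wk , all) =
    let hit = cut es vs wk ; (Pe , Ce) = All.lookupAny all hit in Any.lookup hit , Ce , Pe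

  -- the edges of level L alone form a σ-τ walk, so every cut meets level L
  cut-meets-level : ∀ {C} → IsCut q C → ∀ L → .(L ≤ q) → Σ[ e ∈ Edge q ] (C e ≡ true × level e ≡ L)
  cut-meets-level cut L L≤q = cut-meets cut (detour-from-level L single)
    where
    single : ∀ {k} (m : Vec Bool k) → k ≡ L → Detour (λ e → level e ≡ L) m
    single m refl = detour-edge L≤q m (cong proj₁ (word-edgeAt _ L≤q m))

open Detours using (cut-meets-level)

module _ {q : ℕ} where

  levelEdges : Fin (suc q) → List (Edge q)
  levelEdges j = map (j ,_) (allWords (toℕ j))

  ∈-levelEdges : ∀ j (m : Vec Bool (toℕ j)) → (j , m) ∈ levelEdges j
  ∈-levelEdges j m = ∈-map⁺ (j ,_) (allWords-complete m)

  levelCount : EdgeSet q → Fin (suc q) → ℕ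
  levelCount C j = count C (levelEdges j)

  card-by-level : ∀ C → card C ≡ sum (map (levelCount C) (allFin (suc q)))
  card-by-level C = count-concatMap C levelEdges (allFin (suc q))

  length-allFin : length (allFin (suc q)) ≡ suc q
  length-allFin = length-tabulate (λ j → j)

  cut-levelCount : ∀ {C} → IsCut q C → ∀ j → 1 ≤ levelCount C j
  cut-levelCount {C} cut j with cut-meets-level q cut (toℕ j) (toℕ≤q j)
  ... | (j′ , m) , Cjm , lvl with toℕ-injective lvl
  ...   | refl = count-positive C (∈-levelEdges j m) Cjm

  cut-card : ∀ {C} → IsCut q C → suc q ≤ card C
  cut-card {C} cut = begin
    suc q                                       ≡⟨ sym length-allFin ⟩
    length (allFin (suc q))                     ≤⟨ sum-≥-length (levelCount C) (cut-levelCount cut) (allFin (suc q)) ⟩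
    sum (map (levelCount C) (allFin (suc q)))   ≡⟨ sym (card-by-level C) ⟩
    card C                                      ∎
    where open ≤-Reasoning

  minCut-respects : ∀ {C D : EdgeSet q} → C ≗E D → IsMinCut q C → IsMinCut q D
  minCut-respects C≗D (cut , minimal) =
    (λ es vs wk → Any.map (λ {e} Ce → trans (sym (C≗D e)) Ce) (cut es vs wk)) ,
    (λ D′ cut′ → subst (_≤ card D′) (count-cong C≗D (allEdges q)) (minimal D′ cut′))

-- the edges whose words are suffixes of the leaf word t; these are the
-- images of the edges of the root-leaf path of T_q ending at t
pathCut : ∀ {q} → Vec Bool q → EdgeSet q
pathCut t e = does (proj₂ e ≼? t)

pathCut-spec : ∀ {q} {t : Vec Bool q} {e} → pathCut t e ≡ true ⇔ proj₂ e ≼ t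
pathCut-spec {t = t} {e} = mk⇔ (from-does (proj₂ e ≼? t)) (dec-true (proj₂ e ≼? t))

-- The position of an edge relative to the path cut of a leaf: on the path,
-- or left (σ side) or right (τ side) of it.
data Position : Set where
  left onPath right : Position

descend : Position → Bool → Bool → Position
descend left _ _ = left
descend right _ _ = right
descend onPath _ true = onPath
descend onPath false false = left
descend onPath true false = right

descend-onPath : ∀ {P b x} → descend P b x ≡ onPath → x ≡ true
descend-onPath {onPath} {_} {true} _ = refl
descend-onPath {onPath} {false} {false} ()
descend-onPath {onPath} {true} {false} ()

-- edges left of the path have both endpoints on the σ side
isLeft : Position → Bool
isLeft left = true
isLeft onPath = false
isLeft right = false

module Sides {n : ℕ} (t : Vec Bool n) where

  position : ∀ {j} → Vec Bool j → Position
  position [] = onPath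
  position (b ∷ m) = descend (position m) b (does ((b ∷ m) ≼? t))

  onPath-≼ : ∀ {j} (m : Vec Bool j) → position m ≡ onPath → m ≼ t
  onPath-≼ [] _ = []≼ t
  onPath-≼ (b ∷ m) on = from-does ((b ∷ m) ≼? t) (descend-onPath on)

  -- the 2-colouring of the vertices: true on the σ side of the cut; the new
  -- vertex of a triangle is on the σ side iff the triangle's left side is
  side : Vtx → Bool
  side σ = true
  side τ = false
  side (w _ m) = isLeft (position (false ∷ m))

  side-w : ∀ {j} (m : Vec Bool j) {P} → position m ≡ P →
           side (w j m) ≡ isLeft (descend P false (does ((false ∷ m) ≼? t)))
  side-w m pos = cong (λ P → isLeft (descend P false (does ((false ∷ m) ≼? t)))) pos

  side-w-on : ∀ {j} (m : Vec Bool j) → position m ≡ onPath → (false ∷ m) ≼ t → side (w j m) ≡ false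
  side-w-on m pos p = trans (side-w m pos) (cong (isLeft ∘ descend onPath false) (dec-true (_ ≼? t) p))

  side-w-off : ∀ {j} (m : Vec Bool j) → position m ≡ onPath → ¬ (false ∷ m) ≼ t → side (w j m) ≡ true
  side-w-off m pos np = trans (side-w m pos) (cong (isLeft ∘ descend onPath false) (dec-false (_ ≼? t) np))

  Consistent : Position → Vtx × Vtx → Set
  Consistent left   (a , c) = side a ≡ true  × side c ≡ true
  Consistent onPath (a , c) = side a ≡ true  × side c ≡ false
  Consistent right  (a , c) = side a ≡ false × side c ≡ false

  consistent : ∀ {j} (m : Vec Bool j) → j ≤ n → Consistent (position m) (endsΔ m)
  consistent [] _ = refl , refl
  consistent {suc j} (false ∷ m) j<n rewrite ends-false m
    with position m in pos | consistent m (<⇒≤ j<n)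
  ... | left   | a , _ = a , side-w m pos
  ... | right  | a , _ = a , side-w m pos
  ... | onPath | a , _ with (false ∷ m) ≼? t
  ...   | yes p  = a , side-w-on m pos p
  ...   | no np  = a , side-w-off m pos np
  consistent {suc j} (true ∷ m) j<n rewrite ends-true m
    with position m in pos | consistent m (<⇒≤ j<n)
  ... | left   | _ , c = side-w m pos , c
  ... | right  | _ , c = side-w m pos , c
  ... | onPath | _ , c with (true ∷ m) ≼? t | (false ∷ m) ≼? t
  ...   | yes p  | yes p′ with () ← ≼-unique p′ p refl
  ...   | yes _  | no np′ = side-w-off m pos np′ , c
  ...   | no _   | yes p′ = side-w-on m pos p′ , c
  ...   | no np  | no np′ = ⊥-elim ([ np′ , np ]′ (≼-child (onPath-≼ m pos) j<n))

  bichromatic-on-path : ∀ {j} (m : Vec Bool j) → j ≤ n →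
                        ¬ side (proj₁ (endsΔ m)) ≡ side (proj₂ (endsΔ m)) → m ≼ t
  bichromatic-on-path m j≤n bi with position m in pos | consistent m j≤n
  ... | left   | a , c = ⊥-elim (bi (trans a (sym c)))
  ... | right  | a , c = ⊥-elim (bi (trans a (sym c)))
  ... | onPath | _ = onPath-≼ m pos

-- a path cut contains every bichromatic edge of the colouring, so it is a cut
pathCut-isCut : ∀ {q} (t : Vec Bool q) → IsCut q (pathCut t)
pathCut-isCut {q} t es vs wk = Any.map (λ {e} → on-path e) (crosses side wk refl refl)
  where
  open Sides t
  open WalkFacts (endsTri q)
  on-path : ∀ e → Bichromatic side e → pathCut t e ≡ true
  on-path e bi = Equivalence.from pathCut-spec (bichromatic-on-path (proj₂ e) (level≤ e) bi)

-- a path cut has at most one edge per level, hence at most q + 1 edges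
pathCut-card : ∀ {q} (t : Vec Bool q) → card (pathCut t) ≤ suc q
pathCut-card {q} t = begin
  card (pathCut t)                                    ≡⟨ card-by-level (pathCut t) ⟩
  sum (map (levelCount (pathCut t)) (allFin (suc q))) ≤⟨ sum-≤-length _ one-per-level (allFin (suc q)) ⟩
  length (allFin (suc q))                             ≡⟨ length-allFin ⟩
  suc q                                               ∎
  where
  open ≤-Reasoning
  one-per-level : ∀ j → levelCount (pathCut t) j ≤ 1
  one-per-level j =
    subst (_≤ 1) (sym (count-map (pathCut t) (j ,_) (allWords (toℕ j))))
      (count-≤1 _ same-level (allWords-unique (toℕ j)))
    where
    same-level : ∀ x y → pathCut t (j , x) ≡ true → pathCut t (j , y) ≡ true → x ≡ y
    same-level x y x∈ y∈ = word-injective-at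
      (≼-unique (Equivalence.to pathCut-spec x∈) (Equivalence.to pathCut-spec y∈) refl)

pathCut-min : ∀ {q} (t : Vec Bool q) → IsMinCut q (pathCut t)
pathCut-min t = pathCut-isCut t , λ D cut → ≤-trans (pathCut-card t) (cut-card cut)

-- the leaf t is recovered from its path cut, via the edge of level q
pathCut-injective : ∀ {q} {t t′ : Vec Bool q} → pathCut t ≗E pathCut t′ → t ≡ t′
pathCut-injective {q} {t} {t′} same =
  word-injective-at (trans (sym (word-edgeAt q ≤-refl t)) (≼-unique leaf≼t′ here (cong proj₁ (word-edgeAt q ≤-refl t))))
  where
  leaf : Edge q
  leaf = edgeAt q ≤-refl t
  leaf≼t′ : proj₂ leaf ≼ t′
  leaf≼t′ = Equivalence.to pathCut-spec
    (trans (sym (same leaf)) (Equivalence.from pathCut-spec (≼-cast (word-edgeAt q ≤-refl t) here)))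

module MinCutStructure {q : ℕ} (C : EdgeSet q) (minimum : IsMinCut q C) where
  open Detours q using (Detour; detour-edge; detour-split; detour-from-level; cut-meets)

  cut : IsCut q C
  cut = proj₁ minimum

  -- C is no larger than a path cut, so it has exactly one edge per level
  card≤ : card C ≤ suc q
  card≤ = ≤-trans (proj₂ minimum _ (pathCut-isCut (replicate q false))) (pathCut-card (replicate q false))

  levelCount≤1 : ∀ j → levelCount C j ≤ 1
  levelCount≤1 j = sum-tight (levelCount C) (cut-levelCount cut) (allFin (suc q))
    (subst (_≤ length (allFin (suc q))) (card-by-level C) (≤-trans card≤ (≤-reflexive (sym length-allFin))))
    (∈-allFin j)

  same-level : ∀ e e′ → C e ≡ true → C e′ ≡ true → level e ≡ level e′ → e ≡ e′
  same-level (j , x) (j′ , y) Cx Cy lvl with toℕ-injective lvl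
  ... | refl = count-≤1⇒unique C (levelCount≤1 j) (∈-levelEdges j x) (∈-levelEdges j y) Cx Cy

  same-word : ∀ {k} .(k≤q : k ≤ q) {m m′ : Vec Bool k} →
              C (edgeAt k k≤q m) ≡ true → C (edgeAt k k≤q m′) ≡ true → m ≡ m′
  same-word {k} k≤q {m} {m′} Cm Cm′ = word-injective-at (begin
    (k , m)                 ≡⟨ sym (word-edgeAt k k≤q m) ⟩
    word (edgeAt k k≤q m)   ≡⟨ cong word (same-level _ _ Cm Cm′ (trans (cong proj₁ (word-edgeAt k k≤q m)) (sym (cong proj₁ (word-edgeAt k k≤q m′))))) ⟩
    word (edgeAt k k≤q m′)  ≡⟨ word-edgeAt k k≤q m′ ⟩
    (k , m′)                ∎)
    where open ≡-Reasoning

  word-at-level : ∀ k .(k≤q : k ≤ q) → Σ[ m ∈ Vec Bool k ] C (edgeAt k k≤q m) ≡ true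
  word-at-level k k≤q with cut-meets-level q cut k k≤q
  ... | e , Ce , refl = proj₂ e , subst (λ e′ → C e′ ≡ true) (edgeAt-word e) Ce

  -- If C contains the edge b ∷ y, it contains its parent y.  Otherwise the
  -- level-k edges other than C's edge c, with c replaced by the two other
  -- sides of its triangle, would form a σ-τ walk avoiding C.
  parent-in-C : ∀ {k} .(k<q : suc k ≤ q) b (y : Vec Bool k) →
                C (edgeAt (suc k) k<q (b ∷ y)) ≡ true → C (edgeAt k (<⇒≤ k<q) y) ≡ true
  parent-in-C {k} k<q b y Cby with word-at-level k (<⇒≤ k<q)
  ... | c , Cc with VecP.≡-dec _≟B_ y c
  ...   | yes refl = Cc
  ...   | no y≢c = ⊥-elim (avoided (cut-meets cut (detour-from-level k avoiding)))
    where
    avoided : Σ[ e ∈ Edge q ] (C e ≡ true × C e ≡ false) → ⊥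
    avoided (_ , Ce , C̸e) with () ← trans (sym Ce) C̸e

    child-avoided : ∀ b′ → C (edgeAt (suc k) k<q (b′ ∷ c)) ≡ false
    child-avoided b′ = ¬-not (λ Cc′ → y≢c (VecP.∷-injectiveʳ (same-word k<q Cby Cc′)))

    avoiding : ∀ {k′} (m : Vec Bool k′) → k′ ≡ k → Detour (λ e → C e ≡ false) m
    avoiding m refl with VecP.≡-dec _≟B_ m c
    ... | yes refl = detour-split (detour-edge k<q (false ∷ c) (child-avoided false))
                                  (detour-edge k<q (true ∷ c) (child-avoided true))
    ... | no m≢c = detour-edge (<⇒≤ k<q) m (¬-not (λ Cm → m≢c (same-word (<⇒≤ k<q) Cm Cc)))

  suffix-in-C : ∀ {j k} {x : Vec Bool j} {u : Vec Bool k} .(j≤q : j ≤ q) .(k≤q : k ≤ q) →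
                x ≼ u → C (edgeAt k k≤q u) ≡ true → C (edgeAt j j≤q x) ≡ true
  suffix-in-C _ _ here Cu = Cu
  suffix-in-C j≤q k<q (there x≼u) Cu = suffix-in-C j≤q (<⇒≤ k<q) x≼u (parent-in-C k<q _ _ Cu)

  leaf : Vec Bool q
  leaf = proj₁ (word-at-level q ≤-refl)

  -- C is the path cut of its leaf word: by uniqueness per level, C's
  -- edge of level l is the suffix of the leaf word of length l
  isPathCut : C ≗E pathCut leaf
  isPathCut e = ⇔→≡ (mk⇔ to from)
    where
    C-at : C e ≡ true ⇔ C (edgeAt (level e) (level≤ e) (proj₂ e)) ≡ true
    C-at = mk⇔ (subst (λ e′ → C e′ ≡ true) (edgeAt-word e)) (subst (λ e′ → C e′ ≡ true) (sym (edgeAt-word e)))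

    to : C e ≡ true → pathCut leaf e ≡ true
    to Ce with suffix (level e) (level≤ e) leaf
    ... | x , x≼leaf = Equivalence.from pathCut-spec (subst (_≼ leaf) (sym e≡x) x≼leaf)
      where
      Cx : C (edgeAt (level e) (level≤ e) x) ≡ true
      Cx = suffix-in-C (level≤ e) ≤-refl x≼leaf (proj₂ (word-at-level q ≤-refl))
      e≡x : proj₂ e ≡ x
      e≡x = same-word (level≤ e) (Equivalence.to C-at Ce) Cx

    from : pathCut leaf e ≡ true → C e ≡ true
    from on = Equivalence.from C-at
      (suffix-in-C (level≤ e) ≤-refl (Equivalence.to pathCut-spec on) (proj₂ (word-at-level q ≤-refl)))

pathEdges-∈ : ∀ {q} (es : List (Edge q)) {e} → pathEdges es e ≡ true ⇔ e ∈ es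
pathEdges-∈ es {e} = mk⇔ (to es) (from es)
  where
  to : ∀ es → pathEdges es e ≡ true → e ∈ es
  to (e′ ∷ es) on with e ≟E e′
  ... | yes e≡e′ = here e≡e′
  ... | no _ = there (to es on)
  from : ∀ es → e ∈ es → pathEdges es e ≡ true
  from (e′ ∷ es) e∈ with e ≟E e′
  ... | yes _ = refl
  ... | no e≢e′ with e∈
  ...   | here e≡e′ = ⊥-elim (e≢e′ e≡e′)
  ...   | there e∈es = from es e∈es

module DualTree (q : ℕ) where
  open WT q
  open WalkFacts (endsTree q)

  parentOf : ∀ {k} → Vec Bool k → TVtx
  parentOf [] = root
  parentOf {suc k} (_ ∷ s) = node k s

  Below : ∀ {k} → Vec Bool k → TVtx → Set
  Below y root = ⊥
  Below y (node _ n) = y ≼ n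

  Below? : ∀ {k} (y : Vec Bool k) v → Dec (Below y v)
  Below? y root = no (λ ())
  Below? y (node _ n) = y ≼? n

  Adjacent : ∀ {j} → Vec Bool j → TVtx → TVtx → Set
  Adjacent m u x = (endsT m ≡ (u , x)) ⊎ (endsT m ≡ (x , u))

  nodeAt : Word → TVtx
  nodeAt (j , m) = node j m

  neighbour-of-node : ∀ {j k} (m : Vec Bool j) {s : Vec Bool k} {x} → Adjacent m (node k s) x →
    x ≡ parentOf s ⊎ Σ[ b ∈ Bool ] (_≡_ {A = Word} (j , m) (suc k , b ∷ s) × x ≡ node (suc k) (b ∷ s))
  neighbour-of-node [] (inj₂ refl) = inj₁ refl
  neighbour-of-node (b ∷ m) (inj₁ refl) = inj₂ (b , refl , refl)
  neighbour-of-node (b ∷ m) (inj₂ refl) = inj₁ refl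

  neighbour-of-root : ∀ {j} (m : Vec Bool j) {x} → Adjacent m root x →
                      _≡_ {A = Word} (j , m) (0 , []) × x ≡ node 0 []
  neighbour-of-root [] (inj₁ refl) = refl , refl
  neighbour-of-root [] (inj₂ ())
  neighbour-of-root (_ ∷ _) (inj₂ ())

  exit-edge : ∀ {j k} (m : Vec Bool j) (y : Vec Bool k) {u x} →
              Adjacent m u x → Below y u → ¬ Below y x → x ≡ parentOf y
  exit-edge [] y (inj₁ refl) () _
  exit-edge [] y (inj₂ refl) here _ = refl
  exit-edge (b ∷ m) y (inj₁ refl) below not-below = ⊥-elim (not-below (there below))
  exit-edge (b ∷ m) y (inj₂ refl) below not-below with ≼-∷⁻ below
  ... | inj₁ refl = refl
  ... | inj₂ below′ = ⊥-elim (not-below below′)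

  exit-walk : ∀ {k} (y : Vec Bool k) {u v es vs} → Walk u v es vs → Below y u → ¬ Below y v → parentOf y ∈ vs
  exit-walk y [] below not-below = ⊥-elim (not-below below)
  exit-walk y (step {x = x} e adj wk) below not-below with Below? y x
  ... | yes below′ = there (exit-walk y wk below′ not-below)
  ... | no not-below′ = there (subst (_∈ _) (exit-edge (proj₂ e) y adj below not-below′) (start∈ wk))

  record DownStep {k} (s : Vec Bool k) (t : Vec Bool q) (e : Edge q) (x : TVtx) : Set where
    field
      bit          : Bool
      edge≡        : word e ≡ (suc k , bit ∷ s)
      target≡      : x ≡ node (suc k) (bit ∷ s)
      towards-leaf : (bit ∷ s) ≼ t
      inner        : k < q

  -- proved by exit-walk: a wrong child's subtree could only be left again
  -- through node k s, which the path does not revisit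
  first-step : ∀ {k} {s : Vec Bool k} {t : Vec Bool q} {x es vs} (e : Edge q) →
               Joins e (node k s) x → Walk x (node q t) es vs → Unique (node k s ∷ vs) →
               ¬ parentOf s ∈ vs → DownStep s t e x
  first-step {s = s} {t} e adj wk u above∉ with neighbour-of-node (proj₂ e) adj
  ... | inj₁ refl = ⊥-elim (above∉ (start∈ wk))
  ... | inj₂ (b , e≡ , refl) with (b ∷ s) ≼? t
  ...   | yes b∷s≼t = record { bit = b ; edge≡ = e≡ ; target≡ = refl ; towards-leaf = b∷s≼t
                             ; inner = ≤-trans (≤-reflexive (sym (cong proj₁ e≡))) (level≤ e) }
  ...   | no b∷s⋠t = ⊥-elim (head∉tail u (exit-walk (b ∷ s) wk here b∷s⋠t))

  paths-agree : ∀ {k} {s : Vec Bool k} {t : Vec Bool q} {u₁ u₂ es₁ vs₁ es₂ vs₂} →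
                Walk u₁ (node q t) es₁ vs₁ → Walk u₂ (node q t) es₂ vs₂ →
                u₁ ≡ node k s → u₂ ≡ node k s → Unique vs₁ → Unique vs₂ →
                ¬ parentOf s ∈ vs₁ → ¬ parentOf s ∈ vs₂ → es₁ ≡ es₂
  paths-agree [] [] _ _ _ _ _ _ = refl
  paths-agree [] (step e adj w₂) refl refl _ u₂ _ a₂ =
    ⊥-elim (<-irrefl refl (DownStep.inner (first-step e adj w₂ u₂ (a₂ ∘ there))))
  paths-agree (step e adj w₁) [] refl refl u₁ _ a₁ _ =
    ⊥-elim (<-irrefl refl (DownStep.inner (first-step e adj w₁ u₁ (a₁ ∘ there))))
  paths-agree {k} {s} {t} (step {x = x₁} e₁ adj₁ w₁) (step {x = x₂} e₂ adj₂ w₂) refl refl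
              u₁@(_ ∷ u₁′) u₂@(_ ∷ u₂′) a₁ a₂ =
    cong₂ _∷_ (word-injective (trans (edge≡ d₁) (trans same (sym (edge≡ d₂)))))
              (paths-agree w₁ w₂ (target≡ d₁) (trans (target≡ d₂) (cong nodeAt (sym same)))
                           u₁′ u₂′ (head∉tail u₁) (head∉tail u₂))
    where
    open DownStep
    d₁ : DownStep s t e₁ x₁
    d₁ = first-step e₁ adj₁ w₁ u₁ (a₁ ∘ there)
    d₂ : DownStep s t e₂ x₂
    d₂ = first-step e₂ adj₂ w₂ u₂ (a₂ ∘ there)
    same : _≡_ {A = Word} (suc k , bit d₁ ∷ s) (suc k , bit d₂ ∷ s)
    same = ≼-unique (towards-leaf d₁) (towards-leaf d₂) refl

  root-leaf-unique : ∀ {t : Vec Bool q} {es₁ es₂} → Path root (node q t) es₁ → Path root (node q t) es₂ → es₁ ≡ es₂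
  root-leaf-unique (_ , step e₁ adj₁ w₁ , u₁@(_ ∷ u₁′)) (_ , step e₂ adj₂ w₂ , u₂@(_ ∷ u₂′))
    with neighbour-of-root (proj₂ e₁) adj₁ | neighbour-of-root (proj₂ e₂) adj₂
  ... | e₁≡ , x₁≡ | e₂≡ , x₂≡ =
    cong₂ _∷_ (word-injective (trans e₁≡ (sym e₂≡)))
              (paths-agree w₁ w₂ x₁≡ x₂≡ u₁′ u₂′ (head∉tail u₁) (head∉tail u₂))

  spine : ∀ {k} (s : Vec Bool k) → .(k ≤ q) → List (Edge q)
  spine [] _ = edgeAt 0 z≤n [] ∷ []
  spine {suc k} (b ∷ s) k<q = spine s (<⇒≤ k<q) ++ edgeAt (suc k) k<q (b ∷ s) ∷ []

  spine-∈ : ∀ {k} (s : Vec Bool k) .(k≤q : k ≤ q) {e} → e ∈ spine s k≤q ⇔ proj₂ e ≼ s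
  spine-∈ [] _ {e} = mk⇔ to from
    where
    to : e ∈ spine [] z≤n → proj₂ e ≼ []
    to (here refl) = here
    from : proj₂ e ≼ [] → e ∈ spine [] z≤n
    from e≼[] = here (word-injective (≼[] e≼[]))
  spine-∈ {suc k} (b ∷ s) k<q {e} = mk⇔ to from
    where
    to : e ∈ spine (b ∷ s) k<q → proj₂ e ≼ (b ∷ s)
    to e∈ with ∈-++⁻ (spine s (<⇒≤ k<q)) e∈
    ... | inj₁ e∈spine = there (Equivalence.to (spine-∈ s (<⇒≤ k<q)) e∈spine)
    ... | inj₂ (here refl) = ≼-cast (word-edgeAt (suc k) k<q (b ∷ s)) here
    from : proj₂ e ≼ (b ∷ s) → e ∈ spine (b ∷ s) k<q
    from e≼bs with ≼-∷⁻ e≼bs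
    ... | inj₁ e≡ = ∈-++⁺ʳ (spine s (<⇒≤ k<q)) (here (word-injective (trans e≡ (sym (word-edgeAt (suc k) k<q (b ∷ s))))))
    ... | inj₂ e≼s = ∈-++⁺ˡ (Equivalence.from (spine-∈ s (<⇒≤ k<q)) e≼s)

  depth : TVtx → ℕ
  depth root = 0
  depth (node j _) = suc j

  ends-edgeAtT : ∀ k .(k≤q : k ≤ q) (m : Vec Bool k) → endsTree q (edgeAt k k≤q m) ≡ endsT m
  ends-edgeAtT k k≤q m = cong (λ { (_ , m′) → endsT m′ }) (word-edgeAt k k≤q m)

  spine-path : ∀ {k} (s : Vec Bool k) .(k≤q : k ≤ q) →
               Σ[ vs ∈ List TVtx ] (Walk root (node k s) (spine s k≤q) vs × Unique vs
                                   × All (λ v → depth v ≤ suc k) vs)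
  spine-path [] _ = _ , step (edgeAt 0 z≤n []) (inj₁ (ends-edgeAtT 0 z≤n [])) [] ,
                    ((λ ()) ∷ []) ∷ [] ∷ [] , z≤n ∷ s≤s z≤n ∷ []
  spine-path {suc k} (b ∷ s) k<q with spine-path s (<⇒≤ k<q)
  ... | vs , wk , u , shallow =
    _ , snoc wk (inj₁ (ends-edgeAtT (suc k) k<q (b ∷ s))) ,
    AllPairsP.++⁺ u ([] ∷ []) (All.map (λ d → new-vertex d ∷ []) shallow) ,
    AllP.++⁺ (All.map m≤n⇒m≤1+n shallow) (≤-refl ∷ [])
    where
    -- the new end node (suc k) (b ∷ s) is deeper than all earlier vertices
    new-vertex : ∀ {v} → depth v ≤ suc k → v ≢ node (suc k) (b ∷ s)
    new-vertex d refl = 1+n≰n d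

  spine-rootLeaf : (t : Vec Bool q) → RootLeafPath q (spine t ≤-refl)
  spine-rootLeaf t = let (vs , wk , u , _) = spine-path t ≤-refl in t , vs , wk , u

  path-edges : ∀ {t : Vec Bool q} {es} → Path root (node q t) es → pathEdges es ≗E pathCut t
  path-edges {t} {es} path e = begin
    pathEdges es e                ≡⟨ cong (λ es′ → pathEdges es′ e) (root-leaf-unique path (proj₂ (spine-rootLeaf t))) ⟩
    pathEdges (spine t ≤-refl) e  ≡⟨ ⇔→≡ (⇔.trans (pathEdges-∈ (spine t ≤-refl)) (⇔.trans (spine-∈ t ≤-refl) (⇔.sym pathCut-spec))) ⟩
    pathCut t e                   ∎
    where open ≡-Reasoning

lemma6 : (q : ℕ) →
    ((es : List (Edge q)) → RootLeafPath q es → IsMinCut q (pathEdges es))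
    × ((es es′ : List (Edge q)) → RootLeafPath q es → RootLeafPath q es′ →
    pathEdges es ≗E pathEdges es′ → es ≡ es′)
    × ((C : EdgeSet q) → IsMinCut q C →
    Σ[ es ∈ List (Edge q) ] (RootLeafPath q es × pathEdges es ≗E C))
    × (Σ[ cs ∈ List (EdgeSet q) ]
    (length cs ≡ 2 ^ q × All (IsMinCut q) cs
    × AllPairs (λ C D → ¬ (C ≗E D)) cs
    × ((C : EdgeSet q) → IsMinCut q C → Any (λ D → C ≗E D) cs)))
lemma6 q = to-minCut , injective , surjective , enumeration
  where
  open DualTree q

  to-minCut : (es : List (Edge q)) → RootLeafPath q es → IsMinCut q (pathEdges es)
  to-minCut es (t , path) = minCut-respects (λ e → sym (path-edges path e)) (pathCut-min t)

  injective : (es es′ : List (Edge q)) → RootLeafPath q es → RootLeafPath q es′ →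
              pathEdges es ≗E pathEdges es′ → es ≡ es′
  injective es es′ (t , path) (t′ , path′) same
    with pathCut-injective (λ e → trans (sym (path-edges path e)) (trans (same e) (path-edges path′ e)))
  ... | refl = root-leaf-unique path path′

  surjective : (C : EdgeSet q) → IsMinCut q C → Σ[ es ∈ List (Edge q) ] (RootLeafPath q es × pathEdges es ≗E C)
  surjective C minimum = spine leaf ≤-refl , spine-rootLeaf leaf ,
                         (λ e → trans (path-edges (proj₂ (spine-rootLeaf leaf)) e) (sym (isPathCut e)))
    where open MinCutStructure C minimum

  enumeration : Σ[ cs ∈ List (EdgeSet q) ]
                (length cs ≡ 2 ^ q × All (IsMinCut q) cs × AllPairs (λ C D → ¬ (C ≗E D)) cs
                 × ((C : EdgeSet q) → IsMinCut q C → Any (λ D → C ≗E D) cs))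
  enumeration =
    map pathCut (allWords q) ,
    trans (length-map pathCut (allWords q)) (allWords-length q) ,
    AllP.map⁺ (All.tabulate (λ {t} _ → pathCut-min t)) ,
    AllPairsP.map⁺ (AllPairs.map (λ t≢t′ same → t≢t′ (pathCut-injective same)) (allWords-unique q)) ,
    (λ C minimum → let open MinCutStructure C minimum in
      AnyP.map⁺ (Any.map (λ { refl → isPathCut }) (allWords-complete leaf)))
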